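{- Let $G=(S,T;E)$ with $S=\{s_1,\dots,s_n\}$, $d\in\mathbb Z_+$, $l\in\{1,2,3,4\}$, and let $M,M^*$ be $d$-distance matchings of $G$ such that $M$ is $l$-locally optimal with respect to $M^*$. Then $|M^*|\le\varrho_l|M|$, where $\varrho_1=3$, $\varrho_2=2$, $\varrho_3=\frac95$ and $\varrho_4=\frac53$.
   Context: $G$ is a finite bipartite graph without loops or parallel edges; the nodes of $S$ are in the fixed order $s_1,\dots,s_n$. A $d$-distance matching is a subset $M\subseteq E$ such that every node of $S$ is incident to at most one edge of $M$, and whenever $s_it,s_jt\in M$ with $i\ne j$, $t\in T$, we have $|j-i|\ge d$. For an edge $e^*\in E$ and a $d$-distance matching $M$, the hit set $\mathcal H(e^*,M)$ is the inclusion-wise minimal subset of $M$ such that $(M\setminus\mathcal H(e^*,M))\cup\{e^*\}$ is a $d$-distance matching; for $X\subseteq E$, $\mathcal H(X,M)=\bigcup_{e^*\in X}\mathcal H(e^*,M)$. $M$ is $l$-locally optimal with respect to $M^*$ if there is no $X\subseteq M^*\setminus M$ with $l\ge|X|>|\mathcal H(X,M)|$. -}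

module Defs where

open import Data.Nat using (ℕ; zero; suc; _+_; _≤_; ∣_-_∣)
open import Data.Fin using (Fin; toℕ; _≟_)
open import Data.Bool using (Bool; true; false; _∧_; _∨_; not; if_then_else_)
open import Data.List using (List; allFin; map)
open import Data.Nat.ListAction using (sum)
open import Data.Bool.ListAction using (any)
open import Data.Product using (_×_; _,_)
open import Relation.Nullary using (¬_)
open import Relation.Nullary.Decidable using (⌊_⌋)
open import Relation.Binary.PropositionalEquality using (_≡_; _≢_)
open import Data.Integer using (+_)
open import Data.Rational using (ℚ; _/_)

-- A bipartite graph G = (S,T;E) with S = {s_1..s_n} (as Fin n, in this order)
-- and T = Fin m.  A (simple) edge set is a Boolean relation S × T.
EdgeSet : ℕ → ℕ → Set
EdgeSet n m = Fin n → Fin m → Bool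

module _ {n m : ℕ} where

  _⊆_ : EdgeSet n m → EdgeSet n m → Set
  A ⊆ B = ∀ i t → A i t ≡ true → B i t ≡ true

  _∪_ : EdgeSet n m → EdgeSet n m → EdgeSet n m
  (A ∪ B) i t = A i t ∨ B i t

  _∖_ : EdgeSet n m → EdgeSet n m → EdgeSet n m
  (A ∖ B) i t = A i t ∧ not (B i t)

  ⟦_,_⟧ : Fin n → Fin m → EdgeSet n m
  ⟦ i , t ⟧ i' t' = ⌊ i ≟ i' ⌋ ∧ ⌊ t ≟ t' ⌋

  ∣_∣ₑ : EdgeSet n m → ℕ
  ∣ A ∣ₑ = sum (map (λ i → sum (map (λ t → if A i t then 1 else 0) (allFin m))) (allFin n))

  IsDistMatching : ℕ → EdgeSet n m → EdgeSet n m → Set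
  IsDistMatching d E M =
    (M ⊆ E) ×
    (∀ i t t' → M i t ≡ true → M i t' ≡ true → t ≡ t') ×
    (∀ i j t → M i t ≡ true → M j t ≡ true → i ≢ j → d ≤ ∣ toℕ j - toℕ i ∣)

  IsHitSet : ℕ → EdgeSet n m → Fin n → Fin m → EdgeSet n m → EdgeSet n m → Set
  IsHitSet d E i t M H =
    (H ⊆ M) ×
    IsDistMatching d E ((M ∖ H) ∪ ⟦ i , t ⟧) ×
    (∀ H' → H' ⊆ H → IsDistMatching d E ((M ∖ H') ∪ ⟦ i , t ⟧) → H ⊆ H')

  ⋃ : EdgeSet n m → (Fin n → Fin m → EdgeSet n m) → EdgeSet n m
  ⋃ X H i' t' = any (λ i → any (λ t → X i t ∧ H i t i' t') (allFin m)) (allFin n)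

  -- M is l-locally optimal w.r.t. M*: there is no X ⊆ M* ∖ M with l ≥ |X| > |H(X,M)|,
  -- where H(X,M) = ⋃_{e* ∈ X} H(e*,M) (H given by any assignment of hit sets;
  -- hit sets exist and are unique, so this is the paper's H(X,M)).
  LocallyOptimal : ℕ → EdgeSet n m → ℕ → EdgeSet n m → EdgeSet n m → Set
  LocallyOptimal d E l M M* =
    ∀ (X : EdgeSet n m) → X ⊆ (M* ∖ M) → ∣ X ∣ₑ ≤ l →
    (H : Fin n → Fin m → EdgeSet n m) →
    (∀ i t → X i t ≡ true → IsHitSet d E i t M (H i t)) →
    ∣ X ∣ₑ ≤ ∣ ⋃ X H ∣ₑ

ϱ : ℕ → ℚ
ϱ 1 = + 3 / 1
ϱ 2 = + 2 / 1
ϱ 3 = + 9 / 5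
ϱ 4 = + 5 / 3
ϱ _ = + 0 / 1

-- Write B = M* ∖ M and A = M ∖ M*. An edge b ∈ B hits the edges of M it conflicts with:
-- those at its S-node, and those at its T-node whose S-node is closer than d to its own.
-- Two edges of a d-distance matching never conflict, so b hits at most three edges (one at
-- its S-node and one on either side along its T-node), and symmetrically every a ∈ A is hit
-- by at most three edges of B. Local optimality says that no l or fewer edges of B have
-- their hit sets covered by fewer edges of M; for l ≤ 4 this rules out the sparse
-- configurations of edges of B with one or two hits (for instance two edges of B that both
-- hit only a) that would defeat a discharging argument. Each b ∈ B then sends weight at
-- least p to the edges it hits while each a ∈ A receives at most q, so p|B| ≤ q|A| with
-- q/p = ϱ_l, and adding the common part M ∩ M* gives the bound.

module Submission where

open import Defs

-- A module of its own keeps the ℕ operators used throughout out of the scope of the ℚ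
-- operators in the statement of theorem10.
module DistanceMatchings where

  open import Data.Bool.Base using (Bool; true; false; _∧_; not; if_then_else_)
  open import Data.Bool.Properties using (∨-zeroʳ; ∧-comm) renaming (_≟_ to _≟ᵇ_)
  open import Data.Bool.ListAction using (any)
  open import Data.Fin.Base using (Fin; toℕ; zero; suc)
  open import Data.Fin.Properties using (any?) renaming (_≟_ to _≟ᶠ_)
  open import Data.List.Base using (List; []; _∷_; length; tabulate; map; allFin)
  open import Data.List.Properties using (map-tabulate)
  open import Data.List.Membership.Propositional using (_∈_)
  open import Data.List.Relation.Unary.All as All using (All; []; _∷_)
  open import Data.List.Relation.Unary.All.Properties using (¬Any⇒All¬)
  open import Data.List.Relation.Unary.AllPairs using ([]; _∷_)
  open import Data.List.Relation.Unary.Any using (here; there)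
  open import Data.List.Relation.Unary.Unique.Propositional using (Unique)
  open import Data.Nat.Base using (ℕ; zero; suc; _+_; _*_; _≤_; _<_; z≤n; s≤s; ∣_-_∣; _≡ᵇ_)
  open import Data.Nat.Properties
    using (_≟_; _<?_; ≤-refl; ≤-trans; ≤-reflexive; ≤-total; ≤-pred; ≤ᵇ⇒≤; <⇒≤; <⇒≱; ≮⇒≥; <-irrefl; ≤-<-trans;
           +-comm; +-identityʳ; +-mono-≤; *-comm; *-identityˡ; *-identityʳ; *-zeroʳ; *-distribˡ-+; *-mono-≤; *-monoʳ-≤;
           +-*-semiring; ∣-∣-comm; m≤n⇒∣m-n∣≡n∸m; ∸-monoˡ-≤; ∸-monoʳ-≤; module ≤-Reasoning)
  import Data.Nat.ListAction as List
  open import Algebra.Properties.Semiring.Sum +-*-semiring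
    using (sum; sum-syntax; ∑-distrib-+; ∑-comm; *-distribˡ-sum; *-distribʳ-sum; sum-replicate-zero; sum-cong-≗)
  open import Data.Nat.Coprimality using (1-coprimeTo) renaming (sym to coprime-sym)
  open import Data.Integer.Base as ℤ using (+≤+)
  import Data.Integer.Properties as ℤ
  open import Data.Rational.Base as ℚ using (ℚ; _/_; mkℚ; toℚᵘ) renaming (_≤_ to _≤ℚ_)
  open import Data.Rational.Properties using (normalize-coprime; toℚᵘ-cancel-≤; toℚᵘ-homo-*)
  open import Data.Rational.Unnormalised.Base using (mkℚᵘ; *≤*) renaming (_≃_ to _≃ᵘ_)
  open import Data.Rational.Unnormalised.Properties using (≤-respʳ-≃; ≃-sym; *-congʳ)
  open import Data.Product.Base using (_×_; _,_; proj₁; proj₂; ∃)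
  open import Data.Sum.Base using (_⊎_; inj₁; inj₂)
  open import Data.Empty using (⊥; ⊥-elim)
  open import Function.Base using (_∘_; id; case_of_)
  open import Level using (0ℓ)
  open import Relation.Binary.PropositionalEquality
    using (_≡_; _≢_; refl; sym; trans; cong; cong₂; subst; subst₂; module ≡-Reasoning)
  open import Relation.Nullary using (¬_; Dec; yes; no; does)
  open import Relation.Nullary.Decidable using (map′; _×-dec_; dec-true; dec-false)
  open import Relation.Unary using (Pred; Decidable; _∩_)
  open import Relation.Unary.Properties using (_∩?_; ∁?)

  [_] : Bool → ℕ
  [ b ] = if b then 1 else 0

  ∧-≡-true : ∀ {x y} → x ∧ y ≡ true → x ≡ true × y ≡ true
  ∧-≡-true {true} y≡true = refl , y≡true

  does⇒ : {A : Set} (a? : Dec A) → does a? ≡ true → A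
  does⇒ (yes a) _ = a

  any-sound : {A : Set} (p : A → Bool) (xs : List A) → any p xs ≡ true → ∃ λ x → x ∈ xs × p x ≡ true
  any-sound p (x ∷ xs) any≡true with p x in px
  ... | true  = x , here refl , px
  ... | false = let (y , y∈xs , py) = any-sound p xs any≡true in y , there y∈xs , py

  indicator-split : (f : Bool → ℕ) (x y : Bool) → [ x ] * f y ≡ f true * [ x ∧ y ] + f false * [ x ∧ not y ]
  indicator-split f true  true  = cong₂ _+_ (sym (*-identityʳ (f true))) (sym (*-zeroʳ (f false)))
  indicator-split f true  false = trans (+-comm (f false) 0) (cong₂ _+_ (sym (*-zeroʳ (f true))) (sym (*-identityʳ (f false))))
  indicator-split f false _     = sym (cong₂ _+_ (*-zeroʳ (f true)) (*-zeroʳ (f false)))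

  indicator-zero : {A : Set} (a? : Dec A) → ¬ A → ∀ v → [ does a? ] * v ≡ 0
  indicator-zero (yes a) ¬a _ = ⊥-elim (¬a a)
  indicator-zero (no _)  _  _ = refl

  indicator-bound : (α β γ : ℕ) (x y z : Bool) {v : ℕ} → v ≤ α * [ y ] + (β * [ z ] + γ) →
                    [ x ] * v ≤ α * [ x ∧ y ] + (β * [ x ∧ z ] + γ * [ x ])
  indicator-bound α β γ true y z {v} v≤ =
    subst₂ _≤_ (sym (+-identityʳ v)) (cong (λ c → α * [ y ] + (β * [ z ] + c)) (sym (*-identityʳ γ))) v≤
  indicator-bound _ _ _ false _ _ _ = z≤n

  Edge : ℕ → ℕ → Set
  Edge n m = Fin n × Fin m

  -- Finite sums and counts over the edges S × T

  sum-tabulate : ∀ {k} (f : Fin k → ℕ) → List.sum (tabulate f) ≡ sum f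
  sum-tabulate {zero}  f = refl
  sum-tabulate {suc k} f = cong (f zero +_) (sum-tabulate (f ∘ suc))

  sum-mono : ∀ {k} {f g : Fin k → ℕ} → (∀ i → f i ≤ g i) → sum f ≤ sum g
  sum-mono {zero}  _   = z≤n
  sum-mono {suc k} f≤g = +-mono-≤ (f≤g zero) (sum-mono (f≤g ∘ suc))

  sum-indicator-≟ : ∀ {k} (j : Fin k) → sum (λ i → [ does (i ≟ᶠ j) ]) ≡ 1
  sum-indicator-≟ {suc k} zero = cong suc (sum-replicate-zero k)
  sum-indicator-≟ {suc k} (suc j) = trans (sum-cong-≗ pointwise) (sum-indicator-≟ j)
    where
    pointwise : ∀ i → [ does (suc i ≟ᶠ suc j) ] ≡ [ does (i ≟ᶠ j) ]
    pointwise i with i ≟ᶠ j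
    ... | yes _ = refl
    ... | no  _ = refl

  module _ {n m : ℕ} where

    -- Opaque, so that unification recovers f from ∑ₑ f.
    opaque
      ∑ₑ : (Edge n m → ℕ) → ℕ
      ∑ₑ f = sum (λ i → sum (λ t → f (i , t)))

      ∑ₑ-mono : {f g : Edge n m → ℕ} → (∀ e → f e ≤ g e) → ∑ₑ f ≤ ∑ₑ g
      ∑ₑ-mono f≤g = sum-mono (λ i → sum-mono (λ t → f≤g (i , t)))

      ∑ₑ-cong : {f g : Edge n m → ℕ} → (∀ e → f e ≡ g e) → ∑ₑ f ≡ ∑ₑ g
      ∑ₑ-cong f≗g = sum-cong-≗ (λ i → sum-cong-≗ (λ t → f≗g (i , t)))

      ∑ₑ-+ : (f g : Edge n m → ℕ) → ∑ₑ (λ e → f e + g e) ≡ ∑ₑ f + ∑ₑ g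
      ∑ₑ-+ f g = trans (sum-cong-≗ (λ i → ∑-distrib-+ (λ t → f (i , t)) (λ t → g (i , t))))
                       (∑-distrib-+ (λ i → ∑[ t < m ] f (i , t)) (λ i → ∑[ t < m ] g (i , t)))

      ∑ₑ-* : (k : ℕ) (f : Edge n m → ℕ) → ∑ₑ (λ e → k * f e) ≡ k * ∑ₑ f
      ∑ₑ-* k f = sym (trans (*-distribˡ-sum k (λ i → ∑[ t < m ] f (i , t)))
                            (sum-cong-≗ (λ i → *-distribˡ-sum k (λ t → f (i , t)))))

      ∑ₑ-0 : ∑ₑ (λ _ → 0) ≡ 0
      ∑ₑ-0 = trans (sum-cong-≗ {n} {λ _ → ∑[ t < m ] 0} {λ _ → 0} (λ _ → sum-replicate-zero m))
                   (sum-replicate-zero n)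

      ∑ₑ-comm : (F : Edge n m → Edge n m → ℕ) → ∑ₑ (λ e → ∑ₑ (F e)) ≡ ∑ₑ (λ e′ → ∑ₑ (λ e → F e e′))
      ∑ₑ-comm F = begin
        ∑[ i < n ] ∑[ t < m ] ∑[ j < n ] ∑[ u < m ] F (i , t) (j , u)
          ≡⟨ sum-cong-≗ (λ i → ∑-comm (λ t j → ∑[ u < m ] F (i , t) (j , u))) ⟩
        ∑[ i < n ] ∑[ j < n ] ∑[ t < m ] ∑[ u < m ] F (i , t) (j , u)
          ≡⟨ ∑-comm (λ i j → ∑[ t < m ] ∑[ u < m ] F (i , t) (j , u)) ⟩
        ∑[ j < n ] ∑[ i < n ] ∑[ t < m ] ∑[ u < m ] F (i , t) (j , u)
          ≡⟨ sum-cong-≗ (λ j → sum-cong-≗ (λ i → ∑-comm (λ t u → F (i , t) (j , u)))) ⟩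
        ∑[ j < n ] ∑[ i < n ] ∑[ u < m ] ∑[ t < m ] F (i , t) (j , u)
          ≡⟨ sum-cong-≗ (λ j → ∑-comm (λ i u → ∑[ t < m ] F (i , t) (j , u))) ⟩
        ∑[ j < n ] ∑[ u < m ] ∑[ i < n ] ∑[ t < m ] F (i , t) (j , u)  ∎
        where open ≡-Reasoning

      ∑ₑ-product : (f : Fin n → ℕ) (g : Fin m → ℕ) → ∑ₑ (λ e → f (proj₁ e) * g (proj₂ e)) ≡ sum f * sum g
      ∑ₑ-product f g = trans (sum-cong-≗ (λ i → sym (*-distribˡ-sum (f i) g))) (sym (*-distribʳ-sum (sum g) f))

      ∑ₑ-tabulate : (f : Edge n m → ℕ) →
                    List.sum (map (λ i → List.sum (map (λ t → f (i , t)) (allFin m))) (allFin n)) ≡ ∑ₑ f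
      ∑ₑ-tabulate f = begin
        List.sum (map row (allFin n))  ≡⟨ cong List.sum (map-tabulate id row) ⟩
        List.sum (tabulate row)        ≡⟨ sum-tabulate row ⟩
        ∑[ i < n ] row i               ≡⟨ sum-cong-≗ (λ i → trans (cong List.sum (map-tabulate id (λ t → f (i , t))))
                                                                 (sum-tabulate (λ t → f (i , t)))) ⟩
        ∑ₑ f                           ∎
        where
        open ≡-Reasoning
        row : Fin n → ℕ
        row i = List.sum (map (λ t → f (i , t)) (allFin m))


  module _ {n m : ℕ} where

    _≟ₑ_ : (e e′ : Edge n m) → Dec (e ≡ e′)
    (i , t) ≟ₑ (j , u) =
      map′ (λ (i≡j , t≡u) → cong₂ _,_ i≡j t≡u) (λ e≡e′ → cong proj₁ e≡e′ , cong proj₂ e≡e′)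
           (i ≟ᶠ j ×-dec t ≟ᶠ u)

    open import Data.List.Membership.DecPropositional _≟ₑ_ using (_∈?_)

    ∃? : {P : Pred (Edge n m) 0ℓ} → Decidable P → Dec (∃ P)
    ∃? P? = map′ (λ (i , t , p) → (i , t) , p) (λ ((i , t) , p) → i , t , p)
                 (any? λ i → any? λ t → P? (i , t))

    count : {P : Pred (Edge n m) 0ℓ} → Decidable P → ℕ
    count P? = ∑ₑ (λ e → [ does (P? e) ])

    module _ {P : Pred (Edge n m) 0ℓ} (P? : Decidable P) where

      count-mono : {Q : Pred (Edge n m) 0ℓ} (Q? : Decidable Q) → (∀ {e} → P e → Q e) → count P? ≤ count Q?
      count-mono Q? P⊆Q = ∑ₑ-mono pointwise
        where
        pointwise : ∀ e → [ does (P? e) ] ≤ [ does (Q? e) ]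
        pointwise e with P? e | Q? e
        ... | no _  | _     = z≤n
        ... | yes _ | yes _ = ≤-refl
        ... | yes p | no ¬q = ⊥-elim (¬q (P⊆Q p))

      count-split : {Q : Pred (Edge n m) 0ℓ} (Q? : Decidable Q) → count P? ≡ count (P? ∩? Q?) + count (P? ∩? ∁? Q?)
      count-split Q? = trans (∑ₑ-cong pointwise) (∑ₑ-+ _ _)
        where
        pointwise : ∀ e → [ does (P? e) ] ≡ [ does (P? e) ∧ does (Q? e) ] + [ does (P? e) ∧ not (does (Q? e)) ]
        pointwise e with does (P? e) | does (Q? e)
        ... | true  | true  = refl
        ... | true  | false = refl
        ... | false | _     = refl

      count-empty : (∀ e → ¬ P e) → count P? ≡ 0
      count-empty ¬P = trans (∑ₑ-cong pointwise) ∑ₑ-0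
        where
        pointwise : ∀ e → [ does (P? e) ] ≡ 0
        pointwise e with P? e
        ... | yes p = ⊥-elim (¬P e p)
        ... | no _  = refl

    count-singleton : (e₀ : Edge n m) → count (_≟ₑ e₀) ≡ 1
    count-singleton (j , u) = begin
      ∑ₑ (λ e → [ does (e ≟ₑ (j , u)) ])                               ≡⟨ ∑ₑ-cong pointwise ⟩
      ∑ₑ (λ e → [ does (proj₁ e ≟ᶠ j) ] * [ does (proj₂ e ≟ᶠ u) ])    ≡⟨ ∑ₑ-product _ _ ⟩
      (∑[ i < n ] [ does (i ≟ᶠ j) ]) * (∑[ t < m ] [ does (t ≟ᶠ u) ])  ≡⟨ cong₂ _*_ (sum-indicator-≟ j) (sum-indicator-≟ u) ⟩
      1 ∎
      where
      open ≡-Reasoning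
      pointwise : ∀ e → [ does (e ≟ₑ (j , u)) ] ≡ [ does (proj₁ e ≟ᶠ j) ] * [ does (proj₂ e ≟ᶠ u) ]
      pointwise (i , t) with does (i ≟ᶠ j)
      ... | true  = sym (+-identityʳ _)
      ... | false = refl

    count-≤-length : {P : Pred (Edge n m) 0ℓ} (P? : Decidable P) (xs : List (Edge n m)) →
                     (∀ {e} → P e → e ∈ xs) → count P? ≤ length xs
    count-≤-length P? [] P⊆[] = ≤-reflexive (count-empty P? (λ e p → case P⊆[] p of λ ()))
    count-≤-length P? (x ∷ xs) P⊆x∷xs = begin
      count P?                                         ≡⟨ count-split P? (_≟ₑ x) ⟩
      count (P? ∩? (_≟ₑ x)) + count (P? ∩? ∁? (_≟ₑ x)) ≤⟨ +-mono-≤ at-x elsewhere ⟩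
      1 + length xs                                    ∎
      where
      open ≤-Reasoning
      at-x : count (P? ∩? (_≟ₑ x)) ≤ 1
      at-x = ≤-trans (count-mono (P? ∩? (_≟ₑ x)) (_≟ₑ x) proj₂) (≤-reflexive (count-singleton x))
      elsewhere : count (P? ∩? ∁? (_≟ₑ x)) ≤ length xs
      elsewhere = count-≤-length (P? ∩? ∁? (_≟ₑ x)) xs λ (p , e≢x) → case P⊆x∷xs p of λ
        { (here e≡x) → ⊥-elim (e≢x e≡x) ; (there e∈xs) → e∈xs }

    length-≤-count : {P : Pred (Edge n m) 0ℓ} (P? : Decidable P) {xs : List (Edge n m)} →
                     Unique xs → All P xs → length xs ≤ count P?
    length-≤-count P? {[]} _ _ = z≤n
    length-≤-count P? {x ∷ xs} (x∉xs ∷ unique) (px ∷ pxs) = begin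
      1 + length xs                                    ≤⟨ +-mono-≤ at-x elsewhere ⟩
      count (P? ∩? (_≟ₑ x)) + count (P? ∩? ∁? (_≟ₑ x)) ≡⟨ count-split P? (_≟ₑ x) ⟨
      count P?                                         ∎
      where
      open ≤-Reasoning
      at-x : 1 ≤ count (P? ∩? (_≟ₑ x))
      at-x = ≤-trans (≤-reflexive (sym (count-singleton x))) (count-mono (_≟ₑ x) (P? ∩? (_≟ₑ x)) λ { refl → px , refl })
      elsewhere : length xs ≤ count (P? ∩? ∁? (_≟ₑ x))
      elsewhere = length-≤-count (P? ∩? ∁? (_≟ₑ x)) unique
                    (All.zipWith (λ (py , x≢y) → py , x≢y ∘ sym) (pxs , x∉xs))

    module _ {P : Pred (Edge n m) 0ℓ} (P? : Decidable P) where

      count≤1 : (∀ {e e′} → P e → P e′ → e ≡ e′) → count P? ≤ 1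
      count≤1 P-unique with ∃? P?
      ... | yes (e , pe) = count-≤-length P? (e ∷ []) (λ pe′ → here (P-unique pe′ pe))
      ... | no ¬∃P       = ≤-trans (≤-reflexive (count-empty P? (λ e pe → ¬∃P (e , pe)))) z≤n

      0<count⇒∃ : 1 ≤ count P? → ∃ P
      0<count⇒∃ 1≤count with ∃? P?
      ... | yes ∃P = ∃P
      ... | no ¬∃P = ⊥-elim (<⇒≱ 1≤count (≤-reflexive (count-empty P? (λ e pe → ¬∃P (e , pe)))))

      count≤length⇒∈ : {xs : List (Edge n m)} → Unique xs → All P xs → count P? ≤ length xs →
                       ∀ {e} → P e → e ∈ xs
      count≤length⇒∈ {xs} unique pxs count≤ {e} pe with e ∈? xs
      ... | yes e∈xs = e∈xs
      ... | no  e∉xs = ⊥-elim (<⇒≱ (length-≤-count P? (¬Any⇒All¬ xs e∉xs ∷ unique) (pe ∷ pxs)) count≤)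

    listSet : List (Edge n m) → EdgeSet n m
    listSet xs i t = does ((i , t) ∈? xs)

    count-linear : ∀ (α β γ : ℕ) {P Q R : Pred (Edge n m) 0ℓ} (P? : Decidable P) (Q? : Decidable Q) (R? : Decidable R) →
                   ∑ₑ (λ e → α * [ does (P? e) ] + (β * [ does (Q? e) ] + γ * [ does (R? e) ])) ≡
                   α * count P? + (β * count Q? + γ * count R?)
    count-linear α β γ P? Q? R? =
      trans (∑ₑ-+ _ _) (cong₂ _+_ (∑ₑ-* α _) (trans (∑ₑ-+ _ _) (cong₂ _+_ (∑ₑ-* β _) (∑ₑ-* γ _))))

    double-count : {P Q : Pred (Edge n m) 0ℓ} (P? : Decidable P) (Q? : Decidable Q)
                   (w : Edge n m → Edge n m → ℕ) {p q : ℕ} →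
                   (∀ b → P b → p ≤ ∑ₑ (w b)) →
                   (∀ a → Q a → ∑ₑ (λ b → w b a) ≤ q) → (∀ a → ¬ Q a → ∑ₑ (λ b → w b a) ≡ 0) →
                   p * count P? ≤ q * count Q?
    double-count P? Q? w {p} {q} sends receives unreached = begin
      p * count P?                    ≡⟨ ∑ₑ-* p _ ⟨
      ∑ₑ (λ b → p * [ does (P? b) ])  ≤⟨ ∑ₑ-mono sent ⟩
      ∑ₑ (λ b → ∑ₑ (w b))             ≡⟨ ∑ₑ-comm w ⟩
      ∑ₑ (λ a → ∑ₑ (λ b → w b a))     ≤⟨ ∑ₑ-mono received ⟩
      ∑ₑ (λ a → q * [ does (Q? a) ])  ≡⟨ ∑ₑ-* q _ ⟩
      q * count Q?                    ∎
      where
      open ≤-Reasoning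
      sent : ∀ b → p * [ does (P? b) ] ≤ ∑ₑ (w b)
      sent b with P? b
      ... | yes pb = subst (_≤ ∑ₑ (w b)) (sym (*-identityʳ p)) (sends b pb)
      ... | no _   = subst (_≤ ∑ₑ (w b)) (sym (*-zeroʳ p)) z≤n
      received : ∀ a → ∑ₑ (λ b → w b a) ≤ q * [ does (Q? a) ]
      received a with Q? a
      ... | yes qa = subst (∑ₑ (λ b → w b a) ≤_) (sym (*-identityʳ q)) (receives a qa)
      ... | no ¬qa = ≤-trans (≤-reflexive (unreached a ¬qa)) z≤n

  module _ {m n o : ℕ} (m≤n : m ≤ n) (n≤o : n ≤ o) where

    m≤n≤o⇒∣m-n∣≤∣m-o∣ : ∣ m - n ∣ ≤ ∣ m - o ∣
    m≤n≤o⇒∣m-n∣≤∣m-o∣ = subst₂ _≤_ (sym (m≤n⇒∣m-n∣≡n∸m m≤n)) (sym (m≤n⇒∣m-n∣≡n∸m (≤-trans m≤n n≤o)))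
                                  (∸-monoˡ-≤ m n≤o)

    m≤n≤o⇒∣n-o∣≤∣m-o∣ : ∣ n - o ∣ ≤ ∣ m - o ∣
    m≤n≤o⇒∣n-o∣≤∣m-o∣ = subst₂ _≤_ (sym (m≤n⇒∣m-n∣≡n∸m n≤o)) (sym (m≤n⇒∣m-n∣≡n∸m (≤-trans m≤n n≤o)))
                                  (∸-monoʳ-≤ o m≤n)

  module _ {c d x y : ℕ} where

    close-below : x ≤ c → y ≤ c → ∣ c - x ∣ < d → ∣ c - y ∣ < d → ∣ x - y ∣ < d
    close-below x≤c y≤c cx<d cy<d with ≤-total x y
    ... | inj₁ x≤y = ≤-<-trans (m≤n≤o⇒∣m-n∣≤∣m-o∣ x≤y y≤c) (subst (_< d) (∣-∣-comm c x) cx<d)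
    ... | inj₂ y≤x = ≤-<-trans (≤-trans (≤-reflexive (∣-∣-comm x y)) (m≤n≤o⇒∣m-n∣≤∣m-o∣ y≤x x≤c))
                               (subst (_< d) (∣-∣-comm c y) cy<d)

    close-above : c ≤ x → c ≤ y → ∣ c - x ∣ < d → ∣ c - y ∣ < d → ∣ x - y ∣ < d
    close-above c≤x c≤y cx<d cy<d with ≤-total x y
    ... | inj₁ x≤y = ≤-<-trans (m≤n≤o⇒∣n-o∣≤∣m-o∣ c≤x x≤y) cy<d
    ... | inj₂ y≤x = ≤-<-trans (≤-trans (≤-reflexive (∣-∣-comm x y)) (m≤n≤o⇒∣n-o∣≤∣m-o∣ c≤y y≤x)) cx<d

  module _ {n m : ℕ} where

    _∈ₑ_ : Edge n m → EdgeSet n m → Set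
    e ∈ₑ N = N (proj₁ e) (proj₂ e) ≡ true

    _∈ₑ?_ : (e : Edge n m) (N : EdgeSet n m) → Dec (e ∈ₑ N)
    e ∈ₑ? N = N (proj₁ e) (proj₂ e) ≟ᵇ true

    ∈-∖⁺ : ∀ {A B : EdgeSet n m} e → e ∈ₑ A → ¬ e ∈ₑ B → e ∈ₑ (A ∖ B)
    ∈-∖⁺ {A} {B} (i , t) e∈A e∉B with A i t | B i t
    ... | true  | false = refl
    ... | true  | true  = ⊥-elim (e∉B refl)
    ... | false | _     = case e∈A of λ ()

  -- Conflicting edges

  module Conflicts (d : ℕ) {n m : ℕ} where

    Near : Fin n → Fin n → Set
    Near i j = i ≢ j × ∣ toℕ i - toℕ j ∣ < d

    data Conflict : Edge n m → Edge n m → Set where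
      sameS : ∀ {i t u} → Conflict (i , t) (i , u)
      sameT : ∀ {i j t} → Near i j → Conflict (i , t) (j , t)

    conflict-sym : ∀ {e e′} → Conflict e e′ → Conflict e′ e
    conflict-sym sameS = sameS
    conflict-sym (sameT {i} {j} (i≢j , close)) = sameT (i≢j ∘ sym , subst (_< d) (∣-∣-comm (toℕ i) (toℕ j)) close)

    conflict? : ∀ e e′ → Dec (Conflict e e′)
    conflict? (i , t) (j , u) with i ≟ᶠ j
    ... | yes refl = yes sameS
    ... | no i≢j with t ≟ᶠ u | ∣ toℕ i - toℕ j ∣ <? d
    ...   | yes refl | yes close = yes (sameT (i≢j , close))
    ...   | yes refl | no far    = no λ { sameS → i≢j refl ; (sameT (_ , close)) → far close }
    ...   | no t≢u   | _         = no λ { sameS → i≢j refl ; (sameT _) → t≢u refl }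

    conflict-at-T : ∀ {j k t} → ∣ toℕ j - toℕ k ∣ < d → Conflict (j , t) (k , t)
    conflict-at-T {j} {k} close with j ≟ᶠ k
    ... | yes refl = sameS
    ... | no j≢k   = sameT (j≢k , close)

    ConflictFree : EdgeSet n m → Set
    ConflictFree N = ∀ {e e′} → e ∈ₑ N → e′ ∈ₑ N → Conflict e e′ → e ≡ e′

    module _ {E N : EdgeSet n m} where

      isDistMatching⇒conflictFree : IsDistMatching d E N → ConflictFree N
      isDistMatching⇒conflictFree (_ , one-per-S , spread) {i , t} {i , u} e∈N e′∈N sameS =
        cong (i ,_) (one-per-S i t u e∈N e′∈N)
      isDistMatching⇒conflictFree (_ , one-per-S , spread) {i , t} {j , t} e∈N e′∈N (sameT (i≢j , close)) =
        ⊥-elim (<⇒≱ close (subst (d ≤_) (∣-∣-comm (toℕ j) (toℕ i)) (spread i j t e∈N e′∈N i≢j)))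

      conflictFree⇒isDistMatching : N ⊆ E → ConflictFree N → IsDistMatching d E N
      conflictFree⇒isDistMatching N⊆E free =
        N⊆E ,
        (λ i t u e∈N e′∈N → cong proj₂ (free e∈N e′∈N sameS)) ,
        (λ i j t e∈N e′∈N i≢j → ≮⇒≥ λ close →
           i≢j (cong proj₁ (free e∈N e′∈N (sameT (i≢j , subst (_< d) (∣-∣-comm (toℕ j) (toℕ i)) close)))))

    module _ {i : Fin n} {t : Fin m} where

      conflicts-below : ∀ {a b} → Conflict (i , t) a → toℕ (proj₁ a) < toℕ i →
                        Conflict (i , t) b → toℕ (proj₁ b) < toℕ i → Conflict a b
      conflicts-below sameS            i<i _                _   = ⊥-elim (<-irrefl refl i<i)
      conflicts-below (sameT _)        _   sameS            i<i = ⊥-elim (<-irrefl refl i<i)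
      conflicts-below (sameT (_ , cj)) j<i (sameT (_ , ck)) k<i =
        conflict-at-T (close-below (<⇒≤ j<i) (<⇒≤ k<i) cj ck)

      conflicts-above : ∀ {a b} → Conflict (i , t) a → proj₁ a ≢ i → ¬ toℕ (proj₁ a) < toℕ i →
                        Conflict (i , t) b → proj₁ b ≢ i → ¬ toℕ (proj₁ b) < toℕ i → Conflict a b
      conflicts-above sameS            i≢i _   _                _   _   = ⊥-elim (i≢i refl)
      conflicts-above (sameT _)        _   _   sameS            i≢i _   = ⊥-elim (i≢i refl)
      conflicts-above (sameT (_ , cj)) _   j≮i (sameT (_ , ck)) _   k≮i =
        conflict-at-T (close-above (≮⇒≥ j≮i) (≮⇒≥ k≮i) cj ck)

    conflicts-at-S : ∀ {a b i} → proj₁ a ≡ i → proj₁ b ≡ i → Conflict a b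
    conflicts-at-S {_ , _} {_ , _} refl refl = sameS

    module _ {N : EdgeSet n m} (free : ConflictFree N) where

      clique≤1 : {Q : Pred (Edge n m) 0ℓ} (Q? : Decidable Q) → (∀ {a} → Q a → a ∈ₑ N) →
                 (∀ {a b} → Q a → Q b → Conflict a b) → count Q? ≤ 1
      clique≤1 Q? Q⊆N clique = count≤1 Q? (λ qa qb → free (Q⊆N qa) (Q⊆N qb) (clique qa qb))

      conflicts≤3 : ∀ e → count ((_∈ₑ? N) ∩? conflict? e) ≤ 3
      conflicts≤3 (i , t) = begin
        count P?
          ≡⟨ count-split P? below? ⟩
        count (P? ∩? below?) + count (P? ∩? ∁? below?)
          ≡⟨ cong (count (P? ∩? below?) +_) (count-split (P? ∩? ∁? below?) at-i?) ⟩
        count (P? ∩? below?) + (count ((P? ∩? ∁? below?) ∩? at-i?) + count ((P? ∩? ∁? below?) ∩? ∁? at-i?))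
          ≤⟨ +-mono-≤ below≤1 (+-mono-≤ at-i≤1 above≤1) ⟩
        3 ∎
        where
        open ≤-Reasoning
        P? : Decidable ((λ a → a ∈ₑ N) ∩ Conflict (i , t))
        P? = (_∈ₑ? N) ∩? conflict? (i , t)
        below? : Decidable (λ a → toℕ (proj₁ a) < toℕ i)
        below? a = toℕ (proj₁ a) <? toℕ i
        at-i? : Decidable (λ a → proj₁ a ≡ i)
        at-i? a = proj₁ a ≟ᶠ i
        below≤1 : count (P? ∩? below?) ≤ 1
        below≤1 = clique≤1 (P? ∩? below?) (proj₁ ∘ proj₁)
          λ ((_ , ca) , a<i) ((_ , cb) , b<i) → conflicts-below ca a<i cb b<i
        at-i≤1 : count ((P? ∩? ∁? below?) ∩? at-i?) ≤ 1
        at-i≤1 = clique≤1 ((P? ∩? ∁? below?) ∩? at-i?) (proj₁ ∘ proj₁ ∘ proj₁)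
          λ (_ , a≡i) (_ , b≡i) → conflicts-at-S a≡i b≡i
        above≤1 : count ((P? ∩? ∁? below?) ∩? ∁? at-i?) ≤ 1
        above≤1 = clique≤1 ((P? ∩? ∁? below?) ∩? ∁? at-i?) (proj₁ ∘ proj₁ ∘ proj₁)
          λ (((_ , ca) , a≮i) , a≢i) (((_ , cb) , b≮i) , b≢i) → conflicts-above ca a≢i a≮i cb b≢i b≮i

  module _ {n m : ℕ} {A H : EdgeSet n m} {i : Fin n} {t : Fin m} where

    ∈-exchange⁻ : ∀ e → e ∈ₑ ((A ∖ H) ∪ ⟦ i , t ⟧) → (e ∈ₑ A × ¬ e ∈ₑ H) ⊎ e ≡ (i , t)
    ∈-exchange⁻ (j , u) e∈ with A j u | H j u | i ≟ᶠ j | t ≟ᶠ u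
    ... | true  | false | _        | _        = inj₁ (refl , λ ())
    ... | _     | _     | yes refl | yes refl = inj₂ refl
    ∈-exchange⁻ (j , u) () | true  | true  | yes _ | no _
    ∈-exchange⁻ (j , u) () | true  | true  | no _  | _
    ∈-exchange⁻ (j , u) () | false | _     | yes _ | no _
    ∈-exchange⁻ (j , u) () | false | _     | no _  | _

    ∈-exchange⁺ : ∀ {e} → e ∈ₑ A → ¬ e ∈ₑ H → e ∈ₑ ((A ∖ H) ∪ ⟦ i , t ⟧)
    ∈-exchange⁺ {j , u} e∈A e∉H with A j u | H j u
    ... | true  | false = refl
    ... | true  | true  = ⊥-elim (e∉H refl)
    ... | false | _     = case e∈A of λ ()

    ∈-exchange-new : (i , t) ∈ₑ ((A ∖ H) ∪ ⟦ i , t ⟧)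
    ∈-exchange-new with i ≟ᶠ i | t ≟ᶠ t
    ... | yes _ | yes _ = ∨-zeroʳ _
    ... | no ¬p | _     = ⊥-elim (¬p refl)
    ... | yes _ | no ¬q = ⊥-elim (¬q refl)

  module _ {n m : ℕ} (N : EdgeSet n m) where

    ∣∣ₑ≡count : ∣ N ∣ₑ ≡ count (_∈ₑ? N)
    ∣∣ₑ≡count = trans (∑ₑ-tabulate (λ e → if N (proj₁ e) (proj₂ e) then 1 else 0)) (∑ₑ-cong pointwise)
      where
      pointwise : ∀ e → (if N (proj₁ e) (proj₂ e) then 1 else 0) ≡ [ does (e ∈ₑ? N) ]
      pointwise (i , t) with N i t
      ... | true  = refl
      ... | false = refl

  -- Weight tables of the discharging argument

  -- g k c s is the weight that an edge of M* ∖ M with k hits, c of them pinned (also hit by an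
  -- edge of M* ∖ M with a single hit), sends to each edge it hits; s says whether that edge is pinned.
  Weighting : Set
  Weighting = ℕ → ℕ → Bool → ℕ

  linear-mono : ∀ α β γ {x y z X Y Z : ℕ} → x ≤ X → y ≤ Y → z ≤ Z → α * x + (β * y + γ * z) ≤ α * X + (β * Y + γ * Z)
  linear-mono α β γ x≤X y≤Y z≤Z = +-mono-≤ (*-monoʳ-≤ α x≤X) (+-mono-≤ (*-monoʳ-≤ β y≤Y) (*-monoʳ-≤ γ z≤Z))

  by-profile : (P : ℕ → ℕ → Set) → P 0 1 → P 1 0 → P 0 2 → P 1 1 → P 0 3 → P 1 2 → P 2 1 → P 3 0 →
               ∀ c k → 1 ≤ c + k → c + k ≤ 3 → (c + k ≡ 2 → c ≤ 1) → P c k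
  by-profile P p01 p10 p02 p11 p03 p12 p21 p30 = λ where
    0 1 _ _ _ → p01
    0 2 _ _ _ → p02
    0 3 _ _ _ → p03
    1 0 _ _ _ → p10
    1 1 _ _ _ → p11
    1 2 _ _ _ → p12
    2 1 _ _ _ → p21
    3 0 _ _ _ → p30
    2 0 _ _ c≤1 → case c≤1 refl of λ { (s≤s ()) }
    0 0 () _ _
    0 (suc (suc (suc (suc _)))) _ (s≤s (s≤s (s≤s ()))) _
    1 (suc (suc (suc _)))       _ (s≤s (s≤s (s≤s ()))) _
    2 (suc (suc _))             _ (s≤s (s≤s (s≤s ()))) _
    3 (suc _)                   _ (s≤s (s≤s (s≤s ()))) _
    (suc (suc (suc (suc _)))) _ _ (s≤s (s≤s (s≤s ()))) _

  weight₂ : ℕ → ℕ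
  weight₂ 1 = 2
  weight₂ _ = 1

  weight₃ : Weighting
  weight₃ 1 _ _     = 5
  weight₃ _ _ true  = 2
  weight₃ _ _ false = 3

  weight₄ : Weighting
  weight₄ 1 _ _     = 6
  weight₄ _ _ true  = 2
  weight₄ 2 1 false = 4
  weight₄ 2 _ false = 3
  weight₄ _ _ false = 2

  weight₂-sends : ∀ δ → 1 ≤ δ → 2 ≤ weight₂ δ * δ
  weight₂-sends 1               _ = ≤-refl
  weight₂-sends (suc (suc _))   _ = s≤s (s≤s z≤n)

  weight₂-receives : ∀ k → weight₂ k ≤ 1 * [ k ≡ᵇ 1 ] + 1
  weight₂-receives 0             = ≤-refl
  weight₂-receives 1             = ≤-refl
  weight₂-receives (suc (suc _)) = ≤-refl

  weight₃-sends : ∀ c k → 1 ≤ c + k → c + k ≤ 3 → (c + k ≡ 2 → c ≤ 1) →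
                  5 ≤ weight₃ (c + k) c true * c + weight₃ (c + k) c false * k
  weight₃-sends = by-profile _ (≤ᵇ⇒≤ _ _ _) (≤ᵇ⇒≤ _ _ _) (≤ᵇ⇒≤ _ _ _) (≤ᵇ⇒≤ _ _ _)
                               (≤ᵇ⇒≤ _ _ _) (≤ᵇ⇒≤ _ _ _) (≤ᵇ⇒≤ _ _ _) (≤ᵇ⇒≤ _ _ _)

  weight₄-sends : ∀ c k → 1 ≤ c + k → c + k ≤ 3 → (c + k ≡ 2 → c ≤ 1) →
                  6 ≤ weight₄ (c + k) c true * c + weight₄ (c + k) c false * k
  weight₄-sends = by-profile _ (≤ᵇ⇒≤ _ _ _) (≤ᵇ⇒≤ _ _ _) (≤ᵇ⇒≤ _ _ _) (≤ᵇ⇒≤ _ _ _)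
                               (≤ᵇ⇒≤ _ _ _) (≤ᵇ⇒≤ _ _ _) (≤ᵇ⇒≤ _ _ _) (≤ᵇ⇒≤ _ _ _)

  weight₃-receivesᵗ : ∀ k c → weight₃ k c true ≤ 3 * [ k ≡ᵇ 1 ] + 2
  weight₃-receivesᵗ 0             _ = ≤-refl
  weight₃-receivesᵗ 1             _ = ≤-refl
  weight₃-receivesᵗ (suc (suc _)) _ = ≤-refl

  weight₃-receivesᶠ : ∀ k c → weight₃ k c false ≤ 2 * [ k ≡ᵇ 1 ] + 3
  weight₃-receivesᶠ 0             _ = ≤-refl
  weight₃-receivesᶠ 1             _ = ≤-refl
  weight₃-receivesᶠ (suc (suc _)) _ = ≤-refl

  weight₄-receivesᵗ : ∀ k c → weight₄ k c true ≤ 4 * [ k ≡ᵇ 1 ] + 2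
  weight₄-receivesᵗ 0             _ = ≤-refl
  weight₄-receivesᵗ 1             _ = ≤-refl
  weight₄-receivesᵗ (suc (suc _)) _ = ≤-refl

  weight₄-receivesᶠ : ∀ k c → weight₄ k c false ≤ 6 * [ k ≡ᵇ 1 ] + (1 * [ (k ≡ᵇ 2) ∧ (c ≡ᵇ 1) ] + 3)
  weight₄-receivesᶠ 0                   _             = ≤ᵇ⇒≤ _ _ _
  weight₄-receivesᶠ 1                   _             = ≤ᵇ⇒≤ _ _ _
  weight₄-receivesᶠ 2                   0             = ≤ᵇ⇒≤ _ _ _
  weight₄-receivesᶠ 2                   1             = ≤ᵇ⇒≤ _ _ _
  weight₄-receivesᶠ 2                   (suc (suc _)) = ≤ᵇ⇒≤ _ _ _
  weight₄-receivesᶠ (suc (suc (suc _))) _             = ≤ᵇ⇒≤ _ _ _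

  -- Comparing M with M*

  module Exchange {n m : ℕ} {E : EdgeSet n m} {d : ℕ} {M M* : EdgeSet n m}
                  (M-matching : IsDistMatching d E M) (M*-matching : IsDistMatching d E M*) where

    open Conflicts d
    open import Data.List.Membership.DecPropositional (_≟ₑ_ {n} {m}) using (_∈?_)

    M-free : ConflictFree M
    M-free = isDistMatching⇒conflictFree M-matching

    M*-free : ConflictFree M*
    M*-free = isDistMatching⇒conflictFree M*-matching

    M*∖M M∖M* : Pred (Edge n m) 0ℓ
    M*∖M e = e ∈ₑ M* × ¬ e ∈ₑ M
    M∖M* e = e ∈ₑ M × ¬ e ∈ₑ M*

    M*∖M? : Decidable M*∖M
    M*∖M? = (_∈ₑ? M*) ∩? ∁? (_∈ₑ? M)

    M∖M*? : Decidable M∖M*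
    M∖M*? = (_∈ₑ? M) ∩? ∁? (_∈ₑ? M*)

    Hits : Edge n m → Pred (Edge n m) 0ℓ
    Hits b a = a ∈ₑ M × Conflict b a

    hits? : ∀ b → Decidable (Hits b)
    hits? b = (_∈ₑ? M) ∩? conflict? b

    deg : Edge n m → ℕ
    deg b = count (hits? b)

    deg≤3 : ∀ b → deg b ≤ 3
    deg≤3 = conflicts≤3 M-free

    hitters? : ∀ a → Decidable (λ b → M*∖M b × Hits b a)
    hitters? a b = M*∖M? b ×-dec hits? b a

    hitters≤3 : ∀ a → count (hitters? a) ≤ 3
    hitters≤3 a = ≤-trans (count-mono (hitters? a) ((_∈ₑ? M*) ∩? conflict? a)
                                      (λ ((b∈M* , _) , (_ , conflict)) → b∈M* , conflict-sym conflict))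
                          (conflicts≤3 M*-free a)

    hit⇒M∖M* : ∀ {b a} → M*∖M b → Hits b a → M∖M* a
    hit⇒M∖M* (b∈M* , b∉M) (a∈M , conflict) = a∈M , λ a∈M* → b∉M (subst (_∈ₑ M) (sym (M*-free b∈M* a∈M* conflict)) a∈M)

    hitSet : Edge n m → EdgeSet n m
    hitSet b j u = does (hits? b (j , u))

    isHitSet : ∀ {i t} → M*∖M (i , t) → IsHitSet d E i t M (hitSet (i , t))
    isHitSet {i} {t} (b∈M* , b∉M) = (λ j u → proj₁ ∘ hit) , exchange-valid , minimal
      where
      b : Edge n m
      b = (i , t)
      H : EdgeSet n m
      H = hitSet b
      hit : ∀ {a} → a ∈ₑ H → Hits b a
      hit {a} = does⇒ (hits? b a)
      N : EdgeSet n m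
      N = (M ∖ H) ∪ ⟦ i , t ⟧
      ∈N⁻ : ∀ e → e ∈ₑ N → (e ∈ₑ M × ¬ e ∈ₑ H) ⊎ e ≡ b
      ∈N⁻ = ∈-exchange⁻ {A = M} {H} {i} {t}
      exchange-valid : IsDistMatching d E N
      exchange-valid = conflictFree⇒isDistMatching N⊆E free
        where
        N⊆E : N ⊆ E
        N⊆E j u e∈N with ∈N⁻ (j , u) e∈N
        ... | inj₁ (e∈M , _) = proj₁ M-matching j u e∈M
        ... | inj₂ refl      = proj₁ M*-matching i t b∈M*
        free : ConflictFree N
        free {e} {e′} e∈N e′∈N conflict with ∈N⁻ e e∈N | ∈N⁻ e′ e′∈N
        ... | inj₁ (e∈M , _)   | inj₁ (e′∈M , _)   = M-free e∈M e′∈M conflict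
        ... | inj₁ (e∈M , e∉H) | inj₂ refl         = ⊥-elim (e∉H (dec-true (hits? b e) (e∈M , conflict-sym conflict)))
        ... | inj₂ refl        | inj₁ (e′∈M , e′∉H) = ⊥-elim (e′∉H (dec-true (hits? b e′) (e′∈M , conflict)))
        ... | inj₂ refl        | inj₂ refl         = refl
      minimal : ∀ H′ → H′ ⊆ H → IsDistMatching d E ((M ∖ H′) ∪ ⟦ i , t ⟧) → H ⊆ H′
      minimal H′ _ valid′ j u a∈H with H′ j u in a∈?H′
      ... | true  = refl
      ... | false = ⊥-elim (b∉M (subst (_∈ₑ M) (sym b≡a) a∈M))
        where
        a∈M : (j , u) ∈ₑ M
        a∈M = proj₁ (hit a∈H)
        a∉H′ : ¬ (j , u) ∈ₑ H′
        a∉H′ a∈H′ = case trans (sym a∈?H′) a∈H′ of λ ()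
        b≡a : b ≡ (j , u)
        b≡a = isDistMatching⇒conflictFree valid′ (∈-exchange-new {A = M} {H′})
                                          (∈-exchange⁺ {A = M} {H′} {i} {t} a∈M a∉H′) (proj₂ (hit a∈H))

    Leaf : Pred (Edge n m) 0ℓ
    Leaf p = M*∖M p × deg p ≡ 1

    leaf? : Decidable Leaf
    leaf? p = M*∖M? p ×-dec deg p ≟ 1

    Pinned : Pred (Edge n m) 0ℓ
    Pinned a = ∃ λ p → Leaf p × Hits p a

    pinned? : Decidable Pinned
    pinned? a = ∃? (λ p → leaf? p ×-dec hits? p a)

    pinnedHits unpinnedHits : Edge n m → ℕ
    pinnedHits  b = count (hits? b ∩? pinned?)
    unpinnedHits b = count (hits? b ∩? ∁? pinned?)

    deg-split : ∀ b → deg b ≡ pinnedHits b + unpinnedHits b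
    deg-split b = count-split (hits? b) pinned?

    leafHitters? : ∀ a → Decidable (λ b → (M*∖M b × Hits b a) × deg b ≡ 1)
    leafHitters? a = hitters? a ∩? (λ b → deg b ≟ 1)

    hingeHitters? : ∀ a → Decidable (λ b → (M*∖M b × Hits b a) × deg b ≡ 2 × pinnedHits b ≡ 1)
    hingeHitters? a = hitters? a ∩? (λ b → deg b ≟ 2 ×-dec pinnedHits b ≟ 1)

    no-leafHitters : ∀ {a} → ¬ Pinned a → count (leafHitters? a) ≡ 0
    no-leafHitters ¬pinned = count-empty (leafHitters? _) (λ p ((p∈ , hit) , deg≡1) → ¬pinned (p , (p∈ , deg≡1) , hit))

    hits-within : ∀ {b xs} → Unique xs → All (Hits b) xs → deg b ≤ length xs → ∀ {a} → Hits b a → a ∈ xs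
    hits-within {b} = count≤length⇒∈ (hits? b)

    Pendant : Edge n m → Edge n m → Set
    Pendant p x = Leaf p × Hits p x

    Fork : Edge n m → Edge n m → Edge n m → Set
    Fork b a x = (M*∖M b × deg b ≡ 2) × a ≢ x × Hits b a × Hits b x

    pendant-hits : ∀ {p x a} → Pendant p x → Hits p a → a ≡ x
    pendant-hits ((_ , deg≡1) , px) pa with hits-within ([] ∷ []) (px ∷ []) (≤-reflexive deg≡1) pa
    ... | here a≡x = a≡x

    fork-hits : ∀ {b a x c} → Fork b a x → Hits b c → c ∈ a ∷ x ∷ []
    fork-hits ((_ , deg≡2) , a≢x , ba , bx) =
      hits-within ((a≢x ∷ []) ∷ [] ∷ []) (ba ∷ bx ∷ []) (≤-reflexive deg≡2)

    fork≢pendant : ∀ {b a x p y} → Fork b a x → Pendant p y → b ≢ p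
    fork≢pendant ((_ , deg≡2) , _) ((_ , deg≡1) , _) refl = case trans (sym deg≡2) deg≡1 of λ ()

    pendants-apart : ∀ {p x q y} → Pendant p x → Pendant q y → x ≢ y → p ≢ q
    pendants-apart px (_ , py) x≢y refl = x≢y (sym (pendant-hits px py))

    weight : Weighting → Edge n m → Edge n m → ℕ
    weight g b a = [ does (hitters? a b) ] * g (deg b) (pinnedHits b) (does (pinned? a))

    sent-≡ : ∀ g {b} → M*∖M b →
             ∑ₑ (weight g b) ≡ g (pinnedHits b + unpinnedHits b) (pinnedHits b) true  * pinnedHits b
                             + g (pinnedHits b + unpinnedHits b) (pinnedHits b) false * unpinnedHits b
    sent-≡ g {b} b∈ = begin
      ∑ₑ (weight g b)
        ≡⟨ ∑ₑ-cong pointwise ⟩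
      ∑ₑ (λ a → G true * [ does ((hits? b ∩? pinned?) a) ] + G false * [ does ((hits? b ∩? ∁? pinned?) a) ])
        ≡⟨ trans (∑ₑ-+ _ _) (cong₂ _+_ (∑ₑ-* (G true) _) (∑ₑ-* (G false) _)) ⟩
      G true * pinnedHits b + G false * unpinnedHits b
        ≡⟨ cong (λ δ → g δ (pinnedHits b) true * pinnedHits b + g δ (pinnedHits b) false * unpinnedHits b) (deg-split b) ⟩
      g (pinnedHits b + unpinnedHits b) (pinnedHits b) true  * pinnedHits b
        + g (pinnedHits b + unpinnedHits b) (pinnedHits b) false * unpinnedHits b ∎
      where
      open ≡-Reasoning
      G : Bool → ℕ
      G = g (deg b) (pinnedHits b)
      pointwise : ∀ a → weight g b a ≡ G true * [ does (hits? b a) ∧ does (pinned? a) ]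
                                      + G false * [ does (hits? b a) ∧ not (does (pinned? a)) ]
      pointwise a = subst (λ h → [ h ∧ does (hits? b a) ] * G (does (pinned? a)) ≡
                                 G true * [ does (hits? b a) ∧ does (pinned? a) ]
                                 + G false * [ does (hits? b a) ∧ not (does (pinned? a)) ])
                          (sym (dec-true (M*∖M? b) b∈))
                          (indicator-split G (does (hits? b a)) (does (pinned? a)))

    sends-uniform : (f : ℕ → ℕ) {p : ℕ} → (∀ δ → 1 ≤ δ → p ≤ f δ * δ) → (∀ {b} → M*∖M b → 1 ≤ deg b) →
                    ∀ b → M*∖M b → p ≤ ∑ₑ (weight (λ δ _ _ → f δ) b)
    sends-uniform f {p} enough deg-pos b b∈ =
      subst (p ≤_) (sym (trans (sent-≡ (λ δ _ _ → f δ) b∈) (sym (*-distribˡ-+ (f δ) (pinnedHits b) (unpinnedHits b)))))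
            (enough δ (subst (1 ≤_) (deg-split b) (deg-pos b∈)))
      where
      δ : ℕ
      δ = pinnedHits b + unpinnedHits b

    sends-by-profile : ∀ g {p} →
      (∀ c k → 1 ≤ c + k → c + k ≤ 3 → (c + k ≡ 2 → c ≤ 1) → p ≤ g (c + k) c true * c + g (c + k) c false * k) →
      (∀ {b} → M*∖M b → 1 ≤ deg b) → (∀ {b} → M*∖M b → deg b ≡ 2 → pinnedHits b ≤ 1) →
      ∀ b → M*∖M b → p ≤ ∑ₑ (weight g b)
    sends-by-profile g {p} enough deg-pos pinnedHits≤1 b b∈ =
      subst (p ≤_) (sym (sent-≡ g b∈))
            (enough (pinnedHits b) (unpinnedHits b) (subst (1 ≤_) (deg-split b) (deg-pos b∈))
                    (subst (_≤ 3) (deg-split b) (deg≤3 b)) (pinnedHits≤1 b∈ ∘ trans (deg-split b)))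

    received-≤ : ∀ g (α β γ : ℕ) s → (∀ k c → g k c s ≤ α * [ k ≡ᵇ 1 ] + (β * [ (k ≡ᵇ 2) ∧ (c ≡ᵇ 1) ] + γ)) →
                 ∀ a → does (pinned? a) ≡ s →
                 ∑ₑ (λ b → weight g b a) ≤ α * count (leafHitters? a) + (β * count (hingeHitters? a) + γ * count (hitters? a))
    received-≤ g α β γ s bound a refl =
      ≤-trans (∑ₑ-mono pointwise) (≤-reflexive (count-linear α β γ (leafHitters? a) (hingeHitters? a) (hitters? a)))
      where
      pointwise : ∀ b → weight g b a ≤ α * [ does (leafHitters? a b) ]
                                       + (β * [ does (hingeHitters? a b) ] + γ * [ does (hitters? a b) ])
      pointwise b = indicator-bound α β γ (does (hitters? a b)) (deg b ≡ᵇ 1) ((deg b ≡ᵇ 2) ∧ (pinnedHits b ≡ᵇ 1))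
                                    (bound (deg b) (pinnedHits b))

    ratio : ∀ g {p q} → (∀ b → M*∖M b → p ≤ ∑ₑ (weight g b)) → (∀ a → M∖M* a → ∑ₑ (λ b → weight g b a) ≤ q) →
            p * count M*∖M? ≤ q * count M∖M*?
    ratio g sends receives = double-count M*∖M? M∖M*? (weight g) sends receives unreached
      where
      unreached : ∀ a → ¬ M∖M* a → ∑ₑ (λ b → weight g b a) ≡ 0
      unreached a a∉ = trans (∑ₑ-cong λ b → indicator-zero (hitters? a b) (λ (b∈ , hit) → a∉ (hit⇒M∖M* b∈ hit)) _) ∑ₑ-0

    ratio-on-matchings : ∀ p q → p ≤ q → p * count M*∖M? ≤ q * count M∖M*? → p * ∣ M* ∣ₑ ≤ q * ∣ M ∣ₑ
    ratio-on-matchings p q p≤q gain = begin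
      p * ∣ M* ∣ₑ                          ≡⟨ cong (p *_) (trans (∣∣ₑ≡count M*) (count-split (_∈ₑ? M*) (_∈ₑ? M))) ⟩
      p * (count M*∩M? + count M*∖M?)      ≡⟨ *-distribˡ-+ p _ _ ⟩
      p * count M*∩M? + p * count M*∖M?    ≤⟨ +-mono-≤ (*-mono-≤ p≤q (≤-reflexive shared)) gain ⟩
      q * count M∩M*? + q * count M∖M*?    ≡⟨ *-distribˡ-+ q _ _ ⟨
      q * (count M∩M*? + count M∖M*?)      ≡⟨ cong (q *_) (trans (∣∣ₑ≡count M) (count-split (_∈ₑ? M) (_∈ₑ? M*))) ⟨
      q * ∣ M ∣ₑ                           ∎
      where
      open ≤-Reasoning
      M*∩M? : Decidable (λ e → e ∈ₑ M* × e ∈ₑ M)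
      M*∩M? = (_∈ₑ? M*) ∩? (_∈ₑ? M)
      M∩M*? : Decidable (λ e → e ∈ₑ M × e ∈ₑ M*)
      M∩M*? = (_∈ₑ? M) ∩? (_∈ₑ? M*)
      shared : count M*∩M? ≡ count M∩M*?
      shared = ∑ₑ-cong (λ e → cong [_] (∧-comm (does (e ∈ₑ? M*)) (does (e ∈ₑ? M))))

    module Optimal {l : ℕ} (optimal : LocallyOptimal d E l M M*) where

      expansion : ∀ {xs} → Unique xs → All M*∖M xs → length xs ≤ l →
                  (ys : List (Edge n m)) → (∀ {b a} → b ∈ xs → Hits b a → a ∈ ys) → length xs ≤ length ys
      expansion {xs} unique xs⊆M*∖M xs≤l ys covers = begin
        length xs             ≤⟨ length-≤-count (_∈ₑ? X) unique (All.tabulate λ {e} e∈xs → dec-true (e ∈? xs) e∈xs) ⟩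
        count (_∈ₑ? X)        ≡⟨ ∣∣ₑ≡count X ⟨
        ∣ X ∣ₑ                 ≤⟨ optimal X X⊆M*∖M ∣X∣≤l H (λ i t e∈X → isHitSet (All.lookup xs⊆M*∖M (member e∈X))) ⟩
        ∣ ⋃ X H ∣ₑ             ≡⟨ ∣∣ₑ≡count (⋃ X H) ⟩
        count (_∈ₑ? ⋃ X H)    ≤⟨ count-≤-length (_∈ₑ? ⋃ X H) ys covered ⟩
        length ys             ∎
        where
        open ≤-Reasoning
        X : EdgeSet n m
        X = listSet xs
        H : Fin n → Fin m → EdgeSet n m
        H i t = hitSet (i , t)
        member : ∀ {e} → e ∈ₑ X → e ∈ xs
        member {e} = does⇒ (e ∈? xs)
        X⊆M*∖M : X ⊆ (M* ∖ M)
        X⊆M*∖M i t e∈X = let (e∈M* , e∉M) = All.lookup xs⊆M*∖M (member e∈X) in ∈-∖⁺ {A = M*} {B = M} (i , t) e∈M* e∉M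
        ∣X∣≤l : ∣ X ∣ₑ ≤ l
        ∣X∣≤l = ≤-trans (≤-trans (≤-reflexive (∣∣ₑ≡count X)) (count-≤-length (_∈ₑ? X) xs member)) xs≤l
        covered : ∀ {a} → a ∈ₑ ⋃ X H → a ∈ ys
        covered {j , u} a∈⋃ =
          let (i , _ , row) = any-sound _ (allFin n) a∈⋃
              (t , _ , both) = any-sound _ (allFin m) row
              (b∈X , a∈Hb) = ∧-≡-true both
          in covers (member b∈X) (does⇒ (hits? (i , t) (j , u)) a∈Hb)

      deg-pos : 1 ≤ l → ∀ {b} → M*∖M b → 1 ≤ deg b
      deg-pos 1≤l b∈ = ≮⇒≥ λ deg<1 →
        case expansion ([] ∷ []) (b∈ ∷ []) 1≤l [] (λ { (here refl) → hits-within [] [] (≤-pred deg<1) }) of λ ()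

      leafHitters≤1 : 2 ≤ l → ∀ a → count (leafHitters? a) ≤ 1
      leafHitters≤1 2≤l a = count≤1 (leafHitters? a) same
        where
        same : ∀ {p q} → (M*∖M p × Hits p a) × deg p ≡ 1 → (M*∖M q × Hits q a) × deg q ≡ 1 → p ≡ q
        same {p} {q} ((p∈ , pa) , p-deg) ((q∈ , qa) , q-deg) with p ≟ₑ q
        ... | yes p≡q = p≡q
        ... | no  p≢q = case expansion ((p≢q ∷ []) ∷ [] ∷ []) (p∈ ∷ q∈ ∷ []) 2≤l (a ∷ []) covered of λ { (s≤s ()) }
          where
          covered : ∀ {b c} → b ∈ p ∷ q ∷ [] → Hits b c → c ∈ a ∷ []
          covered (here refl)         = here ∘ pendant-hits ((p∈ , p-deg) , pa)
          covered (there (here refl)) = here ∘ pendant-hits ((q∈ , q-deg) , qa)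

      fork-with-two-pendants : 3 ≤ l → ∀ {b x y p q} → Fork b x y → Pendant p x → Pendant q y → ⊥
      fork-with-two-pendants 3≤l {b} {x} {y} {p} {q} fork@((b∈ , _) , x≢y , _) px@((p∈ , _) , _) qy@((q∈ , _) , _) =
        case expansion unique (b∈ ∷ p∈ ∷ q∈ ∷ []) 3≤l (x ∷ y ∷ []) covered of λ { (s≤s (s≤s ())) }
        where
        unique : Unique (b ∷ p ∷ q ∷ [])
        unique = (fork≢pendant fork px ∷ fork≢pendant fork qy ∷ []) ∷ (pendants-apart px qy x≢y ∷ []) ∷ [] ∷ []
        covered : ∀ {c a} → c ∈ b ∷ p ∷ q ∷ [] → Hits c a → a ∈ x ∷ y ∷ []
        covered (here refl)                 = fork-hits fork
        covered (there (here refl))         = here ∘ pendant-hits px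
        covered (there (there (here refl))) = there ∘ here ∘ pendant-hits qy

      pinnedHits≤1 : 3 ≤ l → ∀ {b} → M*∖M b → deg b ≡ 2 → pinnedHits b ≤ 1
      pinnedHits≤1 3≤l {b} b∈ b-deg = count≤1 (hits? b ∩? pinned?) same
        where
        same : ∀ {x y} → Hits b x × Pinned x → Hits b y × Pinned y → x ≡ y
        same {x} {y} (bx , p , px) (by , q , qy) with x ≟ₑ y
        ... | yes x≡y = x≡y
        ... | no  x≢y = ⊥-elim (fork-with-two-pendants 3≤l ((b∈ , b-deg) , x≢y , bx , by) px qy)

      two-forks-one-pendant : 3 ≤ l → ∀ {b₁ b₂ a x p} → b₁ ≢ b₂ → Fork b₁ a x → Fork b₂ a x → Pendant p x → ⊥
      two-forks-one-pendant 3≤l {b₁} {b₂} {a} {x} {p} b₁≢b₂ fork₁@((b₁∈ , _) , _) fork₂@((b₂∈ , _) , _) px@((p∈ , _) , _) =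
        case expansion unique (b₁∈ ∷ b₂∈ ∷ p∈ ∷ []) 3≤l (a ∷ x ∷ []) covered of λ { (s≤s (s≤s ())) }
        where
        unique : Unique (b₁ ∷ b₂ ∷ p ∷ [])
        unique = (b₁≢b₂ ∷ fork≢pendant fork₁ px ∷ []) ∷ (fork≢pendant fork₂ px ∷ []) ∷ [] ∷ []
        covered : ∀ {c e} → c ∈ b₁ ∷ b₂ ∷ p ∷ [] → Hits c e → e ∈ a ∷ x ∷ []
        covered (here refl)                 = fork-hits fork₁
        covered (there (here refl))         = fork-hits fork₂
        covered (there (there (here refl))) = there ∘ here ∘ pendant-hits px

      two-forks-two-pendants : 4 ≤ l → ∀ {b₁ b₂ a x y p q} → b₁ ≢ b₂ → x ≢ y →
                               Fork b₁ a x → Fork b₂ a y → Pendant p x → Pendant q y → ⊥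
      two-forks-two-pendants 4≤l {b₁} {b₂} {a} {x} {y} {p} {q} b₁≢b₂ x≢y
                             fork₁@((b₁∈ , _) , _) fork₂@((b₂∈ , _) , _) px@((p∈ , _) , _) qy@((q∈ , _) , _) =
        case expansion unique (b₁∈ ∷ b₂∈ ∷ p∈ ∷ q∈ ∷ []) 4≤l (a ∷ x ∷ y ∷ []) covered of λ { (s≤s (s≤s (s≤s ()))) }
        where
        unique : Unique (b₁ ∷ b₂ ∷ p ∷ q ∷ [])
        unique = (b₁≢b₂ ∷ fork≢pendant fork₁ px ∷ fork≢pendant fork₁ qy ∷ [])
               ∷ (fork≢pendant fork₂ px ∷ fork≢pendant fork₂ qy ∷ [])
               ∷ (pendants-apart px qy x≢y ∷ []) ∷ [] ∷ []
        covered : ∀ {c e} → c ∈ b₁ ∷ b₂ ∷ p ∷ q ∷ [] → Hits c e → e ∈ a ∷ x ∷ y ∷ []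
        covered (here refl) hit with fork-hits fork₁ hit
        ... | here e≡a         = here e≡a
        ... | there (here e≡x) = there (here e≡x)
        covered (there (here refl)) hit with fork-hits fork₂ hit
        ... | here e≡a         = here e≡a
        ... | there (here e≡y) = there (there (here e≡y))
        covered (there (there (here refl)))         = there ∘ here ∘ pendant-hits px
        covered (there (there (there (here refl)))) = there ∘ there ∘ here ∘ pendant-hits qy

      hingeHitters≤1 : 4 ≤ l → ∀ {a} → ¬ Pinned a → count (hingeHitters? a) ≤ 1
      hingeHitters≤1 4≤l {a} a-unpinned = count≤1 (hingeHitters? a) same
        where
        3≤l : 3 ≤ l
        3≤l = <⇒≤ 4≤l
        fork-to-leaf : ∀ {b} → M*∖M b → Hits b a → deg b ≡ 2 → pinnedHits b ≡ 1 →
                       ∃ λ x → Fork b a x × ∃ λ p → Pendant p x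
        fork-to-leaf {b} b∈ ba b-deg b-pinnedHits =
          let (x , bx , p , px) = 0<count⇒∃ (hits? b ∩? pinned?) (≤-reflexive (sym b-pinnedHits))
          in x , ((b∈ , b-deg) , (λ { refl → a-unpinned (p , px) }) , ba , bx) , p , px
        same : ∀ {b₁ b₂} → (M*∖M b₁ × Hits b₁ a) × deg b₁ ≡ 2 × pinnedHits b₁ ≡ 1 →
                           (M*∖M b₂ × Hits b₂ a) × deg b₂ ≡ 2 × pinnedHits b₂ ≡ 1 → b₁ ≡ b₂
        same {b₁} {b₂} ((b₁∈ , b₁a) , b₁-deg , b₁-pinnedHits) ((b₂∈ , b₂a) , b₂-deg , b₂-pinnedHits) with b₁ ≟ₑ b₂
        ... | yes b₁≡b₂ = b₁≡b₂
        ... | no  b₁≢b₂ with fork-to-leaf b₁∈ b₁a b₁-deg b₁-pinnedHits | fork-to-leaf b₂∈ b₂a b₂-deg b₂-pinnedHits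
        ...   | x , fork₁ , p , px | y , fork₂ , q , qy with x ≟ₑ y
        ...     | yes refl = ⊥-elim (two-forks-one-pendant 3≤l b₁≢b₂ fork₁ fork₂ px)
        ...     | no  x≢y  = ⊥-elim (two-forks-two-pendants 4≤l b₁≢b₂ x≢y fork₁ fork₂ px qy)

      ratio₁ : 1 ≤ l → 1 * count M*∖M? ≤ 3 * count M∖M*?
      ratio₁ 1≤l = ratio (λ _ _ _ → 1) (sends-uniform (λ _ → 1) enough (deg-pos 1≤l)) received
        where
        enough : ∀ δ → 1 ≤ δ → 1 ≤ 1 * δ
        enough δ = subst (1 ≤_) (sym (*-identityˡ δ))
        received : ∀ a → M∖M* a → ∑ₑ (λ b → weight (λ _ _ _ → 1) b a) ≤ 3
        received a _ = ≤-trans (received-≤ (λ _ _ _ → 1) 0 0 1 _ (λ _ _ → ≤-refl) a refl)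
                               (linear-mono 0 0 1 (≤-refl {count (leafHitters? a)}) (≤-refl {count (hingeHitters? a)})
                                            (hitters≤3 a))

      ratio₂ : 2 ≤ l → 2 * count M*∖M? ≤ 4 * count M∖M*?
      ratio₂ 2≤l = ratio (λ δ _ _ → weight₂ δ) (sends-uniform weight₂ weight₂-sends (deg-pos (<⇒≤ 2≤l))) received
        where
        received : ∀ a → M∖M* a → ∑ₑ (λ b → weight (λ δ _ _ → weight₂ δ) b a) ≤ 4
        received a _ = ≤-trans (received-≤ (λ δ _ _ → weight₂ δ) 1 0 1 _ (λ k _ → weight₂-receives k) a refl)
                               (linear-mono 1 0 1 (leafHitters≤1 2≤l a) (≤-refl {count (hingeHitters? a)}) (hitters≤3 a))

      ratio₃ : 3 ≤ l → 5 * count M*∖M? ≤ 9 * count M∖M*?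
      ratio₃ 3≤l = ratio weight₃ (sends-by-profile weight₃ weight₃-sends (deg-pos (<⇒≤ 2≤l)) (pinnedHits≤1 3≤l)) received
        where
        2≤l : 2 ≤ l
        2≤l = <⇒≤ 3≤l
        received : ∀ a → M∖M* a → ∑ₑ (λ b → weight weight₃ b a) ≤ 9
        received a _ with pinned? a
        ... | yes pinned = ≤-trans (received-≤ weight₃ 3 0 2 true weight₃-receivesᵗ a (dec-true (pinned? a) pinned))
                                   (linear-mono 3 0 2 (leafHitters≤1 2≤l a) (≤-refl {count (hingeHitters? a)}) (hitters≤3 a))
        ... | no ¬pinned = ≤-trans (received-≤ weight₃ 2 0 3 false weight₃-receivesᶠ a (dec-false (pinned? a) ¬pinned))
                                   (linear-mono 2 0 3 (≤-reflexive (no-leafHitters ¬pinned)) (≤-refl {count (hingeHitters? a)})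
                                                (hitters≤3 a))

      ratio₄ : 4 ≤ l → 6 * count M*∖M? ≤ 10 * count M∖M*?
      ratio₄ 4≤l = ratio weight₄ (sends-by-profile weight₄ weight₄-sends (deg-pos 1≤l) (pinnedHits≤1 3≤l)) received
        where
        3≤l : 3 ≤ l
        3≤l = <⇒≤ 4≤l
        1≤l : 1 ≤ l
        1≤l = <⇒≤ (<⇒≤ 3≤l)
        received : ∀ a → M∖M* a → ∑ₑ (λ b → weight weight₄ b a) ≤ 10
        received a _ with pinned? a
        ... | yes pinned = ≤-trans (received-≤ weight₄ 4 0 2 true weight₄-receivesᵗ a (dec-true (pinned? a) pinned))
                                   (linear-mono 4 0 2 (leafHitters≤1 (<⇒≤ 3≤l) a) (≤-refl {count (hingeHitters? a)})
                                                (hitters≤3 a))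
        ... | no ¬pinned = ≤-trans (received-≤ weight₄ 6 1 3 false weight₄-receivesᶠ a (dec-false (pinned? a) ¬pinned))
                                   (linear-mono 6 1 3 (≤-reflexive (no-leafHitters ¬pinned)) (hingeHitters≤1 4≤l ¬pinned)
                                                (hitters≤3 a))

  -- From ℕ to ℚ

  n/1≡mkℚ : ∀ x → ℤ.+ x / 1 ≡ mkℚ (ℤ.+ x) 0 (coprime-sym (1-coprimeTo x))
  n/1≡mkℚ x = normalize-coprime (coprime-sym (1-coprimeTo x))

  ℕ-bound⇒ℚ-bound : (r : ℚ) (q k x y : ℕ) → toℚᵘ r ≃ᵘ mkℚᵘ (ℤ.+ q) k → suc k * x ≤ q * y →
                    (ℤ.+ x / 1) ≤ℚ r ℚ.* (ℤ.+ y / 1)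
  ℕ-bound⇒ℚ-bound r q k x y r≃q/k+1 k+1*x≤q*y rewrite n/1≡mkℚ x | n/1≡mkℚ y =
    toℚᵘ-cancel-≤ (≤-respʳ-≃ (≃-sym (toℚᵘ-homo-* r _)) (≤-respʳ-≃ (*-congʳ (≃-sym r≃q/k+1)) (*≤* cross)))
    where
    cross : ℤ.+ x ℤ.* ℤ.+ suc (k * 1) ℤ.≤ (ℤ.+ q ℤ.* ℤ.+ y) ℤ.* ℤ.+ 1
    cross rewrite *-identityʳ k | ℤ.*-identityʳ (ℤ.+ q ℤ.* ℤ.+ y) | sym (ℤ.pos-* x (suc k)) | sym (ℤ.pos-* q y) =
      +≤+ (subst (_≤ q * y) (*-comm (suc k) x) k+1*x≤q*y)

open DistanceMatchings using (module Exchange; ℕ-bound⇒ℚ-bound)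
open import Data.Nat.Base using (suc; s≤s)
open import Data.Nat.Properties using (≤-refl; ≤ᵇ⇒≤)
open import Data.Rational.Unnormalised.Base using (*≡*)
open import Relation.Binary.PropositionalEquality using (refl)

open import Data.Nat using (ℕ; _≤_)
open import Data.Integer using (+_)
open import Data.Rational using (ℚ; _/_; _*_)
open import Data.Rational using () renaming (_≤_ to _≤ℚ_)

theorem10 : (n m : ℕ) (E : EdgeSet n m) (d : ℕ) → 1 ≤ d →
    (l : ℕ) → 1 ≤ l → l ≤ 4 →
    (M M* : EdgeSet n m) →
    IsDistMatching d E M → IsDistMatching d E M* →
    LocallyOptimal d E l M M* →
    (+ ∣ M* ∣ₑ / 1) ≤ℚ (ϱ l * (+ ∣ M ∣ₑ / 1))
theorem10 _ _ _ _ _ 1 _ _ M M* M-matching M*-matching optimal =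
  ℕ-bound⇒ℚ-bound (ϱ 1) 3 0 ∣ M* ∣ₑ ∣ M ∣ₑ (*≡* refl) (ratio-on-matchings 1 3 (≤ᵇ⇒≤ _ _ _) (ratio₁ ≤-refl))
  where
  open Exchange M-matching M*-matching
  open Optimal optimal
theorem10 _ _ _ _ _ 2 _ _ M M* M-matching M*-matching optimal =
  ℕ-bound⇒ℚ-bound (ϱ 2) 4 1 ∣ M* ∣ₑ ∣ M ∣ₑ (*≡* refl) (ratio-on-matchings 2 4 (≤ᵇ⇒≤ _ _ _) (ratio₂ ≤-refl))
  where
  open Exchange M-matching M*-matching
  open Optimal optimal
theorem10 _ _ _ _ _ 3 _ _ M M* M-matching M*-matching optimal =
  ℕ-bound⇒ℚ-bound (ϱ 3) 9 4 ∣ M* ∣ₑ ∣ M ∣ₑ (*≡* refl) (ratio-on-matchings 5 9 (≤ᵇ⇒≤ _ _ _) (ratio₃ ≤-refl))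
  where
  open Exchange M-matching M*-matching
  open Optimal optimal
theorem10 _ _ _ _ _ 4 _ _ M M* M-matching M*-matching optimal =
  ℕ-bound⇒ℚ-bound (ϱ 4) 10 5 ∣ M* ∣ₑ ∣ M ∣ₑ (*≡* refl) (ratio-on-matchings 6 10 (≤ᵇ⇒≤ _ _ _) (ratio₄ ≤-refl))
  where
  open Exchange M-matching M*-matching
  open Optimal optimal
theorem10 _ _ _ _ _ (suc (suc (suc (suc (suc _))))) _ (s≤s (s≤s (s≤s (s≤s ())))) _ _ _ _ _
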